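{- Let $q\not\equiv0\pmod3$, $\rho\in\mathbb{F}_q^*$, and set $K_{\rho,\gamma}=(\rho,0,\gamma,1)$ for $\gamma\in\mathbb{F}_q$ and $K_{\rho,\infty}=(0,0,1,0)$. Then: $K_{\rho,\gamma}\notin\pi_{\rm osc}(0)$ and $K_{\rho,\gamma}\notin\pi_{\rm osc}(\infty)$ for all $\gamma\in\mathbb{F}_q$; $K_{\rho,\infty}\in\pi_{\rm osc}(0)$, $K_{\rho,\infty}\in\pi_{\rm osc}(\infty)$, and $K_{\rho,\infty}\notin\pi_{\rm osc}(t)$ for $t\in\mathbb{F}_q^*$; for $t\in\mathbb{F}_q^*$, $K_{\rho,0}\in\pi_{\rm osc}(t)$ if and only if $\rho=t^3$. Consequently, $K_{\rho,\infty}$ lies on exactly two osculating planes, i.e. it is a $\mathcal{T}$-point; if $\rho$ is a non-cube in $\mathbb{F}_q$ then $K_{\rho,0}$ is a $0_\Gamma$-point; if $\rho$ is a cube in $\mathbb{F}_q$ then $K_{\rho,0}$ is a $1_\Gamma$-point when $q\equiv-1\pmod 3$ and a $3_\Gamma$-point when $q\equiv1\pmod3$.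
   Context: Twisted cubic $\mathscr{C}=\{P(t)\}$ in $\mathrm{PG}(3,q)$, $P(t)=(t^3,t^2,t,1)$ for $t\in\mathbb{F}_q$, $P(\infty)=(1,0,0,0)$. Osculating planes: $\pi_{\rm osc}(t)$ is the plane $x_0-3tx_1+3t^2x_2-t^3x_3=0$ for $t\in\mathbb{F}_q$, and $\pi_{\rm osc}(\infty)$ is $x_3=0$. A $\mathcal{T}$-point is a point not on $\mathscr{C}$ lying on a tangent to $\mathscr{C}$ (tangent at $P(t)$: line through $P(t)$ and $(3t^2,2t,1,0)$; at $P(\infty)$: line through $(1,0,0,0),(0,1,0,0)$). A $\mu_\Gamma$-point ($\mu\in\{0,1,3\}$) is a point not on $\mathscr{C}$ and not a $\mathcal T$-point lying on exactly $\mu$ osculating planes. -}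

module Defs where

open import Level using (0ℓ)
open import Data.Nat using (ℕ)
open import Data.Fin using (Fin)
open import Data.List using (List; _∷_; map; filter; length; allFin)
open import Data.Maybe using (Maybe; just; nothing)
open import Data.Product using (_×_; ∃; ∃-syntax; _,_)
open import Relation.Nullary using (¬_; Dec)
open import Relation.Binary.PropositionalEquality using (_≡_; _≢_)
open import Relation.Binary.Definitions using (DecidableEquality)
open import Algebra.Core using (Op₁; Op₂)
open import Algebra.Structures using (IsCommutativeRing)
open import Function.Bundles using (_↔_; Inverse)

-- A finite field F_q: a commutative ring (with propositional equality) in which
-- 0 ≠ 1 and every nonzero element is invertible, with decidable equality and an
-- explicit bijection Fin q ↔ Carrier (so q = size is the number of elements).
record FiniteField : Set₁ where
  infixl 6 _+_
  infixl 7 _*_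
  field
    Carrier : Set
    _+_ _*_ : Op₂ Carrier
    -_      : Op₁ Carrier
    0# 1#   : Carrier
    isCommutativeRing : IsCommutativeRing _≡_ _+_ _*_ -_ 0# 1#
    0≢1     : 0# ≢ 1#
    inverse : ∀ x → x ≢ 0# → ∃[ y ] (x * y ≡ 1#)
    _≟_     : DecidableEquality Carrier
    size    : ℕ
    enum    : Fin size ↔ Carrier

module Geometry (F : FiniteField) where
  open FiniteField F

  3# : Carrier
  3# = 1# + 1# + 1#

  -- homogeneous coordinates (x0,x1,x2,x3) of a point of PG(3,q)
  record Vec4 : Set where
    constructor ⟨_,_,_,_⟩
    field
      x0 x1 x2 x3 : Carrier
  open Vec4 public

  scale : Carrier → Vec4 → Vec4
  scale c ⟨ a , b , d , e ⟩ = ⟨ c * a , c * b , c * d , c * e ⟩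

  _⊕_ : Vec4 → Vec4 → Vec4
  ⟨ a , b , c , d ⟩ ⊕ ⟨ a' , b' , c' , d' ⟩ = ⟨ a + a' , b + b' , c + c' , d + d' ⟩

  -- The projective line F_q ∪ {∞}: nothing = ∞.
  Param : Set
  Param = Maybe Carrier

  params : List Param
  params = nothing ∷ map (λ i → just (Inverse.to enum i)) (allFin size)

  P : Param → Vec4
  P (just t) = ⟨ t * t * t , t * t , t , 1# ⟩
  P nothing  = ⟨ 1# , 0# , 0# , 0# ⟩

  OnCurve : Vec4 → Set
  OnCurve K = ∃[ t ] ∃[ c ] (c ≢ 0# × K ≡ scale c (P t))

  TangentDir : Param → Vec4
  TangentDir (just t) = ⟨ 3# * t * t , (1# + 1#) * t , 1# , 0# ⟩
  TangentDir nothing  = ⟨ 0# , 1# , 0# , 0# ⟩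

  OnTangent : Param → Vec4 → Set
  OnTangent t K = ∃[ a ] ∃[ b ] (K ≡ scale a (P t) ⊕ scale b (TangentDir t))

  OnSomeTangent : Vec4 → Set
  OnSomeTangent K = ∃[ t ] OnTangent t K

  oscForm : Param → Vec4 → Carrier
  oscForm (just t) ⟨ a , b , c , d ⟩ =
    a + - (3# * t * b) + 3# * t * t * c + - (t * t * t * d)
  oscForm nothing ⟨ a , b , c , d ⟩ = d

  OnOsc : Param → Vec4 → Set
  OnOsc t K = oscForm t K ≡ 0#

  onOsc? : ∀ K t → Dec (OnOsc t K)
  onOsc? K t = oscForm t K ≟ 0#

  oscCount : Vec4 → ℕ
  oscCount K = length (filter (onOsc? K) params)

  TPoint : Vec4 → Set
  TPoint K = ¬ OnCurve K × OnSomeTangent K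

  MuGammaPoint : ℕ → Vec4 → Set
  MuGammaPoint μ K = ¬ OnCurve K × ¬ TPoint K × oscCount K ≡ μ

  IsCube : Carrier → Set
  IsCube ρ = ∃[ t ] (ρ ≡ t * t * t)

  K : Carrier → Param → Vec4
  K ρ (just γ) = ⟨ ρ , 0# , γ , 1# ⟩
  K ρ nothing  = ⟨ 0# , 0# , 1# , 0# ⟩

module Submission where

-- The incidences are coordinate computations: π_osc(0) is the plane x₀ = 0 and π_osc(∞) the plane
-- x₃ = 0, while the form of π_osc(t) equals 3t² at K_{ρ,∞} and ρ − t³ at K_{ρ,0}. So K_{ρ,∞} lies
-- exactly on π_osc(0) and π_osc(∞) once 3 ≠ 0, and the osculating planes through K_{ρ,0} are those at
-- the cube roots of ρ. Counting those roots is where q mod 3 enters, always through one principle: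
-- if f has period 3 and no fixed points on F_q ∖ Z, its orbits show q ≡ |Z| (mod 3). For x ↦ x + 1
-- (Z = ∅) this gives 3 ≠ 0; for x ↦ u x with u³ = 1 ≠ u (Z = {0}) it shows that cubing is injective
-- when q ≡ 2; and for x ↦ −1/(x + 1) (Z = {0, −1}), whose fixed points are the roots of x² + x + 1,
-- it yields a primitive cube root of unity ω when q ≡ 1, so that s³ has the three cube roots s, sω, sω².

open import Level using (Level; 0ℓ; _⊔_)
open import Defs
open import Algebra.Bundles using (CommutativeRing)
open import Algebra.Structures using (IsCommutativeRing)
open import Data.Empty using (⊥-elim)
open import Data.List using (List; []; _∷_; length; filter; map; allFin)
open import Data.List.Membership.Propositional using (_∈_; _∉_; lose)
open import Data.List.Membership.Propositional.Properties using (∈-filter⁺; ∈-filter⁻; ∈-map⁺; ∈-map⁻; ∈-allFin)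
open import Data.List.Membership.Propositional.Properties.WithK using (unique∧set⇒bag)
open import Data.List.Properties using (length-map; length-tabulate; map-∘)
open import Data.List.Relation.Binary.BagAndSetEquality using (∼bag⇒↭)
open import Data.List.Relation.Binary.Permutation.Propositional.Properties using (↭-length)
open import Data.List.Relation.Unary.All as All using ([]; _∷_)
open import Data.List.Relation.Unary.AllPairs using ([]; _∷_)
open import Data.List.Relation.Unary.Any using (here; there; any?; satisfied)
open import Data.List.Relation.Unary.Unique.Propositional using (Unique)
open import Data.List.Relation.Unary.Unique.Propositional.Properties using (filter⁺; map⁺; allFin⁺)
open import Data.Maybe using (just; nothing)
open import Data.Maybe.Properties using (just-injective)
open import Data.Nat using (suc; _<_; _%_; s≤s; z≤n; NonZero)
open import Data.Nat.Divisibility using (_∣_; divides; ∣m∣n⇒∣m+n; ∣-refl)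
open import Data.Nat.DivMod using ([m+kn]%n≡m%n)
open import Data.Nat.Induction using (<-wellFounded)
import Data.Nat.Properties as ℕ
open import Data.Product using (∃-syntax; _×_; _,_; proj₁; proj₂)
open import Data.Sum using (_⊎_; inj₁; inj₂)
open import Function.Base using (_∘_; case_of_)
open import Function.Properties.Equivalence using () renaming (refl to ⇔-refl; trans to ⇔-trans)
open import Function.Bundles using (_⇔_; mk⇔; Equivalence; Injection; Inverse)
open import Function.Properties.Inverse using (Inverse⇒Injection)
open import Induction.WellFounded using (Acc; acc)
open import Relation.Nullary using (¬_; yes; no)
open import Relation.Unary using (Pred; Decidable)
open import Relation.Unary.Properties using (∁?)
open import Relation.Binary.Definitions using (DecidableEquality)
open import Relation.Binary.PropositionalEquality
  using (_≡_; _≢_; ≢-sym; refl; sym; trans; cong; cong₂; subst; module ≡-Reasoning)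

private
  variable
    a p : Level
    A : Set a

module _ where
  open import Data.Nat using (_+_; _*_)

  d∣m⇒[m+n]%d≡n%d : ∀ {d m} n .{{_ : NonZero d}} → d ∣ m → (m + n) % d ≡ n % d
  d∣m⇒[m+n]%d≡n%d {d} n (divides k refl) = trans (cong (_% d) (ℕ.+-comm (k * d) n)) ([m+kn]%n≡m%n n k d)

≡⇔≡ : {x x′ y y′ : A} → x ≡ x′ → y ≡ y′ → (x ≡ y) ⇔ (x′ ≡ y′)
≡⇔≡ refl refl = ⇔-refl

record FreeOrder3On {A : Set a} (f : A → A) (P : Pred A p) : Set (a ⊔ p) where
  field
    closed : ∀ {x} → P x → P (f x)
    cubed  : ∀ {x} → P x → f (f (f x)) ≡ x
    free   : ∀ {x} → P x → f x ≢ x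

module _ {A : Set a} where
  open import Data.Nat using (_+_)

  unique-⇔⇒length≡ : {xs ys : List A} → Unique xs → Unique ys → (∀ {x} → x ∈ xs ⇔ x ∈ ys) →
                     length xs ≡ length ys
  unique-⇔⇒length≡ xs! ys! xs⇔ys = ↭-length (∼bag⇒↭ (unique∧set⇒bag xs! ys! xs⇔ys))

  module _ {P : Pred A p} (P? : Decidable P) where

    length-filter+length-filter-∁ : ∀ xs → length (filter P? xs) + length (filter (∁? P?) xs) ≡ length xs
    length-filter+length-filter-∁ []       = refl
    length-filter+length-filter-∁ (x ∷ xs) with P? x
    ... | yes _ = cong suc (length-filter+length-filter-∁ xs)
    ... | no  _ = trans (ℕ.+-suc _ _) (cong suc (length-filter+length-filter-∁ xs))

    length-filter≡length : {xs ys : List A} → Unique xs → Unique ys → (∀ {x} → x ∈ ys ⇔ (x ∈ xs × P x)) →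
                           length (filter P? xs) ≡ length ys
    length-filter≡length xs! ys! ys⇔P = unique-⇔⇒length≡ (filter⁺ P? xs!) ys! (mk⇔
      (λ x∈ → Equivalence.from ys⇔P (∈-filter⁻ P? x∈))
      (λ x∈ → let x∈xs , Px = Equivalence.to ys⇔P x∈ in ∈-filter⁺ P? x∈xs Px))

  module _ (_≟_ : DecidableEquality A) where
    open import Data.List.Membership.DecPropositional _≟_ using (_∈?_)

    infixl 5 _∖_
    _∖_ : List A → List A → List A
    xs ∖ zs = filter (∁? (_∈? zs)) xs

    ∈-∖⁺ : ∀ {x xs zs} → x ∈ xs → x ∉ zs → x ∈ xs ∖ zs
    ∈-∖⁺ {zs = zs} = ∈-filter⁺ (∁? (_∈? zs))

    ∈-∖⁻ : ∀ {x xs zs} → x ∈ xs ∖ zs → x ∈ xs × x ∉ zs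
    ∈-∖⁻ {zs = zs} = ∈-filter⁻ (∁? (_∈? zs))

    length-∖ : {xs zs : List A} → Unique xs → Unique zs → (∀ {z} → z ∈ zs → z ∈ xs) →
               length (xs ∖ zs) + length zs ≡ length xs
    length-∖ {xs} {zs} xs! zs! zs⊆xs = begin
      length (xs ∖ zs) + length zs                     ≡⟨ cong (length (xs ∖ zs) +_) zs≡xs∩zs ⟩
      length (xs ∖ zs) + length (filter (_∈? zs) xs)   ≡⟨ ℕ.+-comm (length (xs ∖ zs)) _ ⟩
      length (filter (_∈? zs) xs) + length (xs ∖ zs)   ≡⟨ length-filter+length-filter-∁ (_∈? zs) xs ⟩
      length xs                                        ∎
      where
      open ≡-Reasoning
      zs≡xs∩zs : length zs ≡ length (filter (_∈? zs) xs)
      zs≡xs∩zs = sym (length-filter≡length (_∈? zs) xs! zs! (mk⇔ (λ z∈ → zs⊆xs z∈ , z∈) proj₂))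

    module _ {f : A → A} where

      ∖-invariant : {xs zs : List A} → FreeOrder3On f (_∈ xs) → (∀ {z} → z ∈ zs → f z ∈ zs) →
                    FreeOrder3On f (_∈ xs ∖ zs)
      ∖-invariant {xs} {zs} f-xs zs-invariant = record
        { closed = λ y∈ → let y∈xs , y∉zs = ∈-∖⁻ y∈ in
            ∈-∖⁺ (closed y∈xs) (λ fy∈zs → y∉zs (subst (_∈ zs) (cubed y∈xs) (zs-invariant (zs-invariant fy∈zs))))
        ; cubed  = λ y∈ → cubed (proj₁ (∈-∖⁻ y∈))
        ; free   = λ y∈ → free (proj₁ (∈-∖⁻ y∈))
        }
        where open FreeOrder3On f-xs

      orbit : A → List A
      orbit x = x ∷ f x ∷ f (f x) ∷ []

      orbit-invariant : ∀ {x z} → f (f (f x)) ≡ x → z ∈ orbit x → f z ∈ orbit x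
      orbit-invariant f³x≡x (here refl)                 = there (here refl)
      orbit-invariant f³x≡x (there (here refl))         = there (there (here refl))
      orbit-invariant f³x≡x (there (there (here refl))) = here f³x≡x

      3∣length : {xs : List A} → Unique xs → FreeOrder3On f (_∈ xs) → 3 ∣ length xs
      3∣length = go (<-wellFounded _)
        where
        go : ∀ {xs} → Acc _<_ (length xs) → Unique xs → FreeOrder3On f (_∈ xs) → 3 ∣ length xs
        go {[]}         _         _   _    = divides 0 refl
        go {xs@(x ∷ _)} (acc rec) xs! f-xs =
          subst (3 ∣_) length-rest+3 (∣m∣n⇒∣m+n (go (rec shorter) rest! f-rest) ∣-refl)
          where
          open FreeOrder3On f-xs
          x∈ : x ∈ xs
          x∈ = here refl
          orbit⊆xs : ∀ {z} → z ∈ orbit x → z ∈ xs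
          orbit⊆xs (here refl)                 = x∈
          orbit⊆xs (there (here refl))         = closed x∈
          orbit⊆xs (there (there (here refl))) = closed (closed x∈)
          orbit! : Unique (orbit x)
          orbit! = (≢-sym (free x∈) ∷ (λ x≡f²x → free x∈ (trans (cong f x≡f²x) (cubed x∈))) ∷ [])
                 ∷ (≢-sym (free (closed x∈)) ∷ []) ∷ [] ∷ []
          rest! : Unique (xs ∖ orbit x)
          rest! = filter⁺ (∁? (_∈? orbit x)) xs!
          f-rest : FreeOrder3On f (_∈ xs ∖ orbit x)
          f-rest = ∖-invariant f-xs (orbit-invariant (cubed x∈))
          length-rest+3 : length (xs ∖ orbit x) + 3 ≡ length xs
          length-rest+3 = length-∖ xs! orbit! orbit⊆xs
          shorter : length (xs ∖ orbit x) < length xs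
          shorter = subst (length (xs ∖ orbit x) <_) length-rest+3 (ℕ.m<m+n _ (s≤s z≤n))

      length%3≡length%3 : {xs zs : List A} → Unique xs → (∀ x → x ∈ xs) → Unique zs →
                          FreeOrder3On f (_∉ zs) → length xs % 3 ≡ length zs % 3
      length%3≡length%3 {xs} {zs} xs! xs-complete zs! f-off-zs = begin
        length xs % 3                       ≡⟨ cong (_% 3) (length-∖ xs! zs! (λ {z} _ → xs-complete z)) ⟨
        (length (xs ∖ zs) + length zs) % 3  ≡⟨ d∣m⇒[m+n]%d≡n%d (length zs) (3∣length rest! f-rest) ⟩
        length zs % 3                       ∎
        where
        open ≡-Reasoning
        open FreeOrder3On f-off-zs
        rest! : Unique (xs ∖ zs)
        rest! = filter⁺ (∁? (_∈? zs)) xs!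
        f-rest : FreeOrder3On f (_∈ xs ∖ zs)
        f-rest = record
          { closed = λ y∈ → ∈-∖⁺ (xs-complete _) (closed (y∉zs y∈))
          ; cubed  = λ y∈ → cubed (y∉zs y∈)
          ; free   = λ y∈ → free (y∉zs y∈)
          }
          where
          y∉zs : ∀ {y} → y ∈ xs ∖ zs → y ∉ zs
          y∉zs = proj₂ ∘ ∈-∖⁻ {xs = xs}

module FiniteFieldProperties (F : FiniteField) where
  open FiniteField F
  open Geometry F using (3#)
  open IsCommutativeRing isCommutativeRing public
    using (+-assoc; +-comm; +-identityˡ; +-identityʳ; -‿inverseˡ; *-assoc; *-comm; *-identityˡ; *-identityʳ; zeroˡ; zeroʳ)

  commutativeRing : CommutativeRing 0ℓ 0ℓ
  commutativeRing = record { isCommutativeRing = isCommutativeRing }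

  open import Algebra.Properties.Ring (CommutativeRing.ring commutativeRing) public
    using (-0#≈0#; +-cancelˡ; +-cancelʳ; x∙y⁻¹≈ε⇒x≈y; x≈y⇒x∙y⁻¹≈ε)
  open import Algebra.Solver.Ring.NaturalCoefficients.Default
    (CommutativeRing.commutativeSemiring commutativeRing) public
    using (solve; _:=_; _:+_; _:*_; con)
  open ≡-Reasoning

  1≢0 : 1# ≢ 0#
  1≢0 = ≢-sym 0≢1

  infix 8 _⁻¹
  _⁻¹ : Carrier → Carrier
  x ⁻¹ with x ≟ 0#
  ... | yes _   = 0#
  ... | no  x≢0 = proj₁ (inverse x x≢0)

  x*x⁻¹≡1 : ∀ {x} → x ≢ 0# → x * x ⁻¹ ≡ 1#
  x*x⁻¹≡1 {x} x≢0 with x ≟ 0#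
  ... | yes x≡0 = ⊥-elim (x≢0 x≡0)
  ... | no  x≢0 = proj₂ (inverse x x≢0)

  x*y*y⁻¹≡x : ∀ x {y} → y ≢ 0# → x * y * y ⁻¹ ≡ x
  x*y*y⁻¹≡x x {y} y≢0 = trans (*-assoc x y (y ⁻¹)) (trans (cong (x *_) (x*x⁻¹≡1 y≢0)) (*-identityʳ x))

  *-cancelʳ : ∀ {x y z} → z ≢ 0# → x * z ≡ y * z → x ≡ y
  *-cancelʳ {x} {y} z≢0 xz≡yz =
    trans (sym (x*y*y⁻¹≡x x z≢0)) (trans (cong (_* _ ⁻¹) xz≡yz) (x*y*y⁻¹≡x y z≢0))

  *-cancelˡ : ∀ {x y z} → x ≢ 0# → x * y ≡ x * z → y ≡ z
  *-cancelˡ {x} {y} {z} x≢0 xy≡xz = *-cancelʳ x≢0 (trans (*-comm y x) (trans xy≡xz (*-comm x z)))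

  *-cancelʳ⊎≡0 : ∀ {x y z} → x * z ≡ y * z → x ≡ y ⊎ z ≡ 0#
  *-cancelʳ⊎≡0 {z = z} xz≡yz with z ≟ 0#
  ... | yes z≡0 = inj₂ z≡0
  ... | no  z≢0 = inj₁ (*-cancelʳ z≢0 xz≡yz)

  x*y≢0 : ∀ {x y} → x ≢ 0# → y ≢ 0# → x * y ≢ 0#
  x*y≢0 {x} x≢0 y≢0 xy≡0 = y≢0 (*-cancelˡ x≢0 (trans xy≡0 (sym (zeroʳ x))))

  -x≡0 : ∀ {x} → x ≡ 0# → - x ≡ 0#
  -x≡0 x≡0 = trans (cong -_ x≡0) -0#≈0#

  x-y≡0⇔x≡y : ∀ {x y} → x + - y ≡ 0# ⇔ x ≡ y
  x-y≡0⇔x≡y = mk⇔ (x∙y⁻¹≈ε⇒x≈y _ _) x≈y⇒x∙y⁻¹≈ε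

  x*y⁻¹*y≡x : ∀ x {y} → y ≢ 0# → x * y ⁻¹ * y ≡ x
  x*y⁻¹*y≡x x {y} y≢0 =
    trans (solve 3 (λ x i y → x :* i :* y := x :* y :* i) refl x (y ⁻¹) y) (x*y*y⁻¹≡x x y≢0)

  s³≢0⇒s≢0 : ∀ {s} → s * s * s ≢ 0# → s ≢ 0#
  s³≢0⇒s≢0 s³≢0 s≡0 = s³≢0 (trans (cong (λ u → u * u * u) s≡0) (zeroʳ (0# * 0#)))

  elements : List Carrier
  elements = map (Inverse.to enum) (allFin size)

  elements! : Unique elements
  elements! = map⁺ (Injection.injective (Inverse⇒Injection enum)) (allFin⁺ size)

  ∈-elements : ∀ x → x ∈ elements
  ∈-elements x = subst (_∈ elements) (Inverse.strictlyInverseˡ enum x) (∈-map⁺ _ (∈-allFin _))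

  length-elements : length elements ≡ size
  length-elements = trans (length-map _ (allFin size)) (length-tabulate _)

  size%3≡length%3 : ∀ {f zs} → Unique zs → FreeOrder3On f (_∉ zs) → size % 3 ≡ length zs % 3
  size%3≡length%3 zs! f-off-zs =
    subst (λ n → n % 3 ≡ _) length-elements (length%3≡length%3 _≟_ elements! ∈-elements zs! f-off-zs)

  3#≢0 : size % 3 ≢ 0 → 3# ≢ 0#
  3#≢0 size%3≢0 3≡0 = size%3≢0 (size%3≡length%3 {f = _+ 1#} {zs = []} [] record
    { closed = λ _ ()
    ; cubed  = λ {x} _ → x+3≡x x
    ; free   = λ {x} _ x+1≡x → 1≢0 (+-cancelˡ x 1# 0# (trans x+1≡x (sym (+-identityʳ x))))
    })
    where
    x+3≡x : ∀ x → x + 1# + 1# + 1# ≡ x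
    x+3≡x x = begin
      x + 1# + 1# + 1#  ≡⟨ solve 1 (λ x → x :+ con 1 :+ con 1 :+ con 1 := x :+ (con 1 :+ con 1 :+ con 1)) refl x ⟩
      x + 3#            ≡⟨ cong (x +_) 3≡0 ⟩
      x + 0#            ≡⟨ +-identityʳ x ⟩
      x                 ∎

  u³≡1⇒u≡1 : size % 3 ≡ 2 → ∀ {u} → u * u * u ≡ 1# → u ≡ 1#
  u³≡1⇒u≡1 size%3≡2 {u} u³≡1 with u ≟ 1#
  ... | yes u≡1 = u≡1
  ... | no  u≢1 = ⊥-elim (1≢2 (trans (sym (size%3≡length%3 {zs = 0# ∷ []} ([] ∷ []) u*-off-0)) size%3≡2))
    where
    1≢2 : 1 ≢ 2
    1≢2 ()
    u≢0 : u ≢ 0#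
    u≢0 u≡0 = 1≢0 (trans (sym u³≡1) (trans (cong (λ v → v * v * v) u≡0) (zeroʳ (0# * 0#))))
    u*-off-0 : FreeOrder3On (u *_) (_∉ 0# ∷ [])
    u*-off-0 = record
      { closed = λ x∉ → λ { (here ux≡0) → x*y≢0 u≢0 (x∉ ∘ here) ux≡0 }
      ; cubed  = λ {x} _ → begin
          u * (u * (u * x))  ≡⟨ solve 2 (λ u x → u :* (u :* (u :* x)) := u :* u :* u :* x) refl u x ⟩
          u * u * u * x      ≡⟨ cong (_* x) u³≡1 ⟩
          1# * x             ≡⟨ *-identityˡ x ⟩
          x                  ∎
      ; free   = λ {x} x∉ ux≡x → u≢1 (*-cancelʳ (x∉ ∘ here) (trans ux≡x (sym (*-identityˡ x))))
      }

  cube-injective : size % 3 ≡ 2 → ∀ {s t} → s ≢ 0# → t * t * t ≡ s * s * s → t ≡ s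
  cube-injective size%3≡2 {s} {t} s≢0 t³≡s³ = begin
    t                 ≡⟨ x*y⁻¹*y≡x t s≢0 ⟨
    t * s ⁻¹ * s      ≡⟨ cong (_* s) (u³≡1⇒u≡1 size%3≡2 [ts⁻¹]³≡1) ⟩
    1# * s            ≡⟨ *-identityˡ s ⟩
    s                 ∎
    where
    [ts⁻¹]³≡1 : t * s ⁻¹ * (t * s ⁻¹) * (t * s ⁻¹) ≡ 1#
    [ts⁻¹]³≡1 = begin
      t * s ⁻¹ * (t * s ⁻¹) * (t * s ⁻¹)    ≡⟨ solve 2 (λ t i → t :* i :* (t :* i) :* (t :* i) := t :* t :* t :* (i :* i :* i)) refl t (s ⁻¹) ⟩
      t * t * t * (s ⁻¹ * s ⁻¹ * s ⁻¹)      ≡⟨ cong (_* (s ⁻¹ * s ⁻¹ * s ⁻¹)) t³≡s³ ⟩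
      s * s * s * (s ⁻¹ * s ⁻¹ * s ⁻¹)      ≡⟨ solve 2 (λ s i → s :* s :* s :* (i :* i :* i) := s :* i :* (s :* i) :* (s :* i)) refl s (s ⁻¹) ⟩
      s * s ⁻¹ * (s * s ⁻¹) * (s * s ⁻¹)    ≡⟨ cong (λ v → v * v * v) (x*x⁻¹≡1 s≢0) ⟩
      1# * 1# * 1#                          ≡⟨ solve 0 (con 1 :* con 1 :* con 1 := con 1) refl ⟩
      1#                                    ∎

  ≡cube⇔∈[s] : size % 3 ≡ 2 → ∀ {ρ s} → ρ ≢ 0# → ρ ≡ s * s * s → ∀ {t} → ρ ≡ t * t * t ⇔ t ∈ s ∷ []
  ≡cube⇔∈[s] size%3≡2 ρ≢0 ρ≡s³ = mk⇔
    (λ ρ≡t³ → here (cube-injective size%3≡2 (s³≢0⇒s≢0 (ρ≢0 ∘ trans ρ≡s³)) (trans (sym ρ≡t³) ρ≡s³)))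
    (λ { (here refl) → ρ≡s³ })

  module Order3Möbius where

    m : Carrier
    m = - 1#

    m+1≡0 : m + 1# ≡ 0#
    m+1≡0 = -‿inverseˡ 1#

    m≢0 : m ≢ 0#
    m≢0 m≡0 = 1≢0 (trans (sym (+-identityˡ 1#)) (trans (cong (_+ 1#) (sym m≡0)) m+1≡0))

    [0,m]! : Unique (0# ∷ m ∷ [])
    [0,m]! = (≢-sym m≢0 ∷ []) ∷ [] ∷ []

    x+1≢0 : ∀ {x} → x ∉ 0# ∷ m ∷ [] → x + 1# ≢ 0#
    x+1≢0 {x} x∉ x+1≡0 = x∉ (there (here (+-cancelʳ 1# x m (trans x+1≡0 (sym m+1≡0)))))

    g : Carrier → Carrier
    g x = m * (x + 1#) ⁻¹

    g[x]*[x+1]≡m : ∀ {x} → x ∉ 0# ∷ m ∷ [] → g x * (x + 1#) ≡ m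
    g[x]*[x+1]≡m x∉ = x*y⁻¹*y≡x m (x+1≢0 x∉)

    g-closed : ∀ {x} → x ∉ 0# ∷ m ∷ [] → g x ∉ 0# ∷ m ∷ []
    g-closed {x} x∉ (here gx≡0) = m≢0 (begin
      m                  ≡⟨ g[x]*[x+1]≡m x∉ ⟨
      g x * (x + 1#)     ≡⟨ cong (_* (x + 1#)) gx≡0 ⟩
      0# * (x + 1#)      ≡⟨ zeroˡ (x + 1#) ⟩
      0#                 ∎)
    g-closed {x} x∉ (there (here gx≡m)) = x∉ (here (+-cancelʳ 1# x 0# (begin
      x + 1#             ≡⟨ *-cancelˡ m≢0 (trans (cong (_* (x + 1#)) (sym gx≡m)) (trans (g[x]*[x+1]≡m x∉) (sym (*-identityʳ m)))) ⟩
      1#                 ≡⟨ +-identityˡ 1# ⟨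
      0# + 1#            ∎)))

    g-cubed : ∀ {x} → x ∉ 0# ∷ m ∷ [] → g (g (g x)) ≡ x
    g-cubed {x} x∉ = *-cancelʳ (x+1≢0 z∉) (trans (g[x]*[x+1]≡m z∉) (sym x[z+1]≡m))
      where
      y z : Carrier
      y = g x
      z = g y
      y∉ : y ∉ 0# ∷ m ∷ []
      y∉ = g-closed x∉
      z∉ : z ∉ 0# ∷ m ∷ []
      z∉ = g-closed y∉
      [y+1][x+1]≡x : (y + 1#) * (x + 1#) ≡ x
      [y+1][x+1]≡x = begin
        (y + 1#) * (x + 1#)      ≡⟨ solve 2 (λ y x → (y :+ con 1) :* (x :+ con 1) := y :* (x :+ con 1) :+ (x :+ con 1)) refl y x ⟩
        y * (x + 1#) + (x + 1#)  ≡⟨ cong (_+ (x + 1#)) (g[x]*[x+1]≡m x∉) ⟩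
        m + (x + 1#)             ≡⟨ solve 2 (λ m x → m :+ (x :+ con 1) := x :+ (m :+ con 1)) refl m x ⟩
        x + (m + 1#)             ≡⟨ cong (x +_) m+1≡0 ⟩
        x + 0#                   ≡⟨ +-identityʳ x ⟩
        x                        ∎
      x[z+1]≡m : x * (z + 1#) ≡ m
      x[z+1]≡m = begin
        x * (z + 1#)                   ≡⟨ solve 2 (λ x z → x :* (z :+ con 1) := z :* x :+ x) refl x z ⟩
        z * x + x                      ≡⟨ cong (λ v → z * v + x) [y+1][x+1]≡x ⟨
        z * ((y + 1#) * (x + 1#)) + x  ≡⟨ cong (_+ x) (sym (*-assoc z (y + 1#) (x + 1#))) ⟩
        z * (y + 1#) * (x + 1#) + x    ≡⟨ cong (λ v → v * (x + 1#) + x) (g[x]*[x+1]≡m y∉) ⟩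
        m * (x + 1#) + x               ≡⟨ solve 2 (λ m x → m :* (x :+ con 1) :+ x := m :+ x :* (m :+ con 1)) refl m x ⟩
        m + x * (m + 1#)               ≡⟨ cong (λ v → m + x * v) m+1≡0 ⟩
        m + x * 0#                     ≡⟨ cong (m +_) (zeroʳ x) ⟩
        m + 0#                         ≡⟨ +-identityʳ m ⟩
        m                              ∎

    g-fixed⇒root : ∀ {x} → x ∉ 0# ∷ m ∷ [] → g x ≡ x → x * x + x + 1# ≡ 0#
    g-fixed⇒root {x} x∉ gx≡x = begin
      x * x + x + 1#       ≡⟨ solve 1 (λ x → x :* x :+ x :+ con 1 := x :* (x :+ con 1) :+ con 1) refl x ⟩
      x * (x + 1#) + 1#    ≡⟨ cong (λ v → v * (x + 1#) + 1#) gx≡x ⟨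
      g x * (x + 1#) + 1#  ≡⟨ cong (_+ 1#) (g[x]*[x+1]≡m x∉) ⟩
      m + 1#               ≡⟨ m+1≡0 ⟩
      0#                   ∎

  ∃x²+x+1≡0 : size % 3 ≡ 1 → ∃[ ω ] ω * ω + ω + 1# ≡ 0#
  ∃x²+x+1≡0 size%3≡1 with any? (λ x → (x * x + x + 1#) ≟ 0#) elements
  ... | yes root = satisfied root
  ... | no ¬root = ⊥-elim (2≢1 (trans (sym (size%3≡length%3 [0,m]! g-order3)) size%3≡1))
    where
    open Order3Möbius
    2≢1 : 2 ≢ 1
    2≢1 ()
    g-order3 : FreeOrder3On g (_∉ 0# ∷ m ∷ [])
    g-order3 = record
      { closed = g-closed
      ; cubed  = g-cubed
      ; free   = λ x∉ gx≡x → ¬root (lose (∈-elements _) (g-fixed⇒root x∉ gx≡x))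
      }

  module PrimitiveCubeRootOfUnity {ω} (ω²+ω+1≡0 : ω * ω + ω + 1# ≡ 0#) where

    s[ω²+ω+1]≡0 : ∀ s → s * (ω * ω) + s * ω + s ≡ 0#
    s[ω²+ω+1]≡0 s = begin
      s * (ω * ω) + s * ω + s   ≡⟨ solve 2 (λ s w → s :* (w :* w) :+ s :* w :+ s := s :* (w :* w :+ w :+ con 1)) refl s ω ⟩
      s * (ω * ω + ω + 1#)      ≡⟨ cong (s *_) ω²+ω+1≡0 ⟩
      s * 0#                    ≡⟨ zeroʳ s ⟩
      0#                        ∎

    ω³≡1 : ω * ω * ω ≡ 1#
    ω³≡1 = +-cancelʳ (ω * ω + ω + 1#) _ _ (begin
      ω * ω * ω + (ω * ω + ω + 1#)  ≡⟨ solve 1 (λ w → w :* w :* w :+ (w :* w :+ w :+ con 1) := w :* (w :* w :+ w :+ con 1) :+ con 1) refl ω ⟩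
      ω * (ω * ω + ω + 1#) + 1#     ≡⟨ cong (λ v → ω * v + 1#) ω²+ω+1≡0 ⟩
      ω * 0# + 1#                   ≡⟨ cong (_+ 1#) (zeroʳ ω) ⟩
      0# + 1#                       ≡⟨ +-comm 0# 1# ⟩
      1# + 0#                       ≡⟨ cong (1# +_) ω²+ω+1≡0 ⟨
      1# + (ω * ω + ω + 1#)         ∎)

    -- t³ - s³ = (t - s)(t - sω)(t - sω²), with each factor split off by cancellation.
    cube-roots : ∀ {s t} → t * t * t ≡ s * s * s → t ≡ s ⊎ t ≡ s * ω ⊎ t ≡ s * (ω * ω)
    cube-roots {s} {t} t³≡s³ with *-cancelʳ⊎≡0 {t} {s} {t * t + t * s + s * s} tQ≡sQ
      where
      tQ≡sQ : t * (t * t + t * s + s * s) ≡ s * (t * t + t * s + s * s)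
      tQ≡sQ = begin
        t * (t * t + t * s + s * s)      ≡⟨ solve 2 (λ t s → t :* (t :* t :+ t :* s :+ s :* s) := t :* t :* t :+ (t :* t :* s :+ t :* s :* s)) refl t s ⟩
        t * t * t + (t * t * s + t * s * s) ≡⟨ cong (_+ (t * t * s + t * s * s)) t³≡s³ ⟩
        s * s * s + (t * t * s + t * s * s) ≡⟨ solve 2 (λ t s → s :* s :* s :+ (t :* t :* s :+ t :* s :* s) := s :* (t :* t :+ t :* s :+ s :* s)) refl t s ⟩
        s * (t * t + t * s + s * s)      ∎
    ... | inj₁ t≡s = inj₁ t≡s
    ... | inj₂ Q≡0 with *-cancelʳ⊎≡0 {t} {s * ω} {t + s * ω + s} tR≡sωR
      where
      t²+ts≡[sω]²+sωs : t * t + t * s ≡ s * ω * (s * ω) + s * ω * s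
      t²+ts≡[sω]²+sωs = +-cancelʳ (s * s) _ _ (begin
        t * t + t * s + s * s                  ≡⟨ Q≡0 ⟩
        0#                                     ≡⟨ s[ω²+ω+1]≡0 (s * s) ⟨
        s * s * (ω * ω) + s * s * ω + s * s    ≡⟨ solve 2 (λ s w → s :* s :* (w :* w) :+ s :* s :* w :+ s :* s := s :* w :* (s :* w) :+ s :* w :* s :+ s :* s) refl s ω ⟩
        s * ω * (s * ω) + s * ω * s + s * s    ∎)
      tR≡sωR : t * (t + s * ω + s) ≡ s * ω * (t + s * ω + s)
      tR≡sωR = begin
        t * (t + s * ω + s)                        ≡⟨ solve 3 (λ t s w → t :* (t :+ s :* w :+ s) := t :* t :+ t :* s :+ t :* (s :* w)) refl t s ω ⟩
        t * t + t * s + t * (s * ω)                ≡⟨ cong (_+ t * (s * ω)) t²+ts≡[sω]²+sωs ⟩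
        s * ω * (s * ω) + s * ω * s + t * (s * ω)  ≡⟨ solve 3 (λ t s w → s :* w :* (s :* w) :+ s :* w :* s :+ t :* (s :* w) := s :* w :* (t :+ s :* w :+ s)) refl t s ω ⟩
        s * ω * (t + s * ω + s)                    ∎
    ... | inj₁ t≡sω = inj₂ (inj₁ t≡sω)
    ... | inj₂ R≡0 = inj₂ (inj₂ (+-cancelʳ (s * ω + s) _ _ (begin
      t + (s * ω + s)            ≡⟨ +-assoc t (s * ω) s ⟨
      t + s * ω + s              ≡⟨ R≡0 ⟩
      0#                         ≡⟨ s[ω²+ω+1]≡0 s ⟨
      s * (ω * ω) + s * ω + s    ≡⟨ +-assoc (s * (ω * ω)) (s * ω) s ⟩
      s * (ω * ω) + (s * ω + s)  ∎)))

    [sω]³≡s³ : ∀ s → s * ω * (s * ω) * (s * ω) ≡ s * s * s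
    [sω]³≡s³ s = begin
      s * ω * (s * ω) * (s * ω)  ≡⟨ solve 2 (λ s w → s :* w :* (s :* w) :* (s :* w) := s :* s :* s :* (w :* w :* w)) refl s ω ⟩
      s * s * s * (ω * ω * ω)    ≡⟨ cong (s * s * s *_) ω³≡1 ⟩
      s * s * s * 1#             ≡⟨ *-identityʳ (s * s * s) ⟩
      s * s * s                  ∎

    [sω²]³≡s³ : ∀ s → s * (ω * ω) * (s * (ω * ω)) * (s * (ω * ω)) ≡ s * s * s
    [sω²]³≡s³ s = begin
      s * (ω * ω) * (s * (ω * ω)) * (s * (ω * ω))  ≡⟨ solve 2 (λ s w → s :* (w :* w) :* (s :* (w :* w)) :* (s :* (w :* w)) := s :* w :* (s :* w) :* (s :* w) :* (w :* w :* w)) refl s ω ⟩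
      s * ω * (s * ω) * (s * ω) * (ω * ω * ω)      ≡⟨ cong₂ _*_ ([sω]³≡s³ s) ω³≡1 ⟩
      s * s * s * 1#                               ≡⟨ *-identityʳ (s * s * s) ⟩
      s * s * s                                    ∎

    cube-roots! : 3# ≢ 0# → ∀ {s} → s ≢ 0# → Unique (s ∷ s * ω ∷ s * (ω * ω) ∷ [])
    cube-roots! 3≢0 {s} s≢0 = (s≢sω ∷ s≢sω² ∷ []) ∷ (sω≢sω² ∷ []) ∷ [] ∷ []
      where
      ω≢1 : ω ≢ 1#
      ω≢1 ω≡1 = 3≢0 (begin
        1# + 1# + 1#         ≡⟨ cong (λ v → v + 1# + 1#) (*-identityʳ 1#) ⟨
        1# * 1# + 1# + 1#    ≡⟨ cong (λ v → v * v + v + 1#) ω≡1 ⟨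
        ω * ω + ω + 1#       ≡⟨ ω²+ω+1≡0 ⟩
        0#                   ∎)
      ω≢0 : ω ≢ 0#
      ω≢0 ω≡0 = 1≢0 (begin
        1#                   ≡⟨ solve 0 (con 1 := con 0 :* con 0 :+ con 0 :+ con 1) refl ⟩
        0# * 0# + 0# + 1#    ≡⟨ cong (λ v → v * v + v + 1#) ω≡0 ⟨
        ω * ω + ω + 1#       ≡⟨ ω²+ω+1≡0 ⟩
        0#                   ∎)
      s≢sω : s ≢ s * ω
      s≢sω s≡sω = ω≢1 (sym (*-cancelˡ s≢0 (trans (*-identityʳ s) s≡sω)))
      sω≢sω² : s * ω ≢ s * (ω * ω)
      sω≢sω² sω≡sω² = ω≢1 (sym (*-cancelˡ ω≢0 (trans (*-identityʳ ω) (*-cancelˡ s≢0 sω≡sω²))))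
      s≢sω² : s ≢ s * (ω * ω)
      s≢sω² s≡sω² = ω≢1 (begin
        ω                ≡⟨ *-identityʳ ω ⟨
        ω * 1#           ≡⟨ cong (ω *_) (*-cancelˡ s≢0 (trans (*-identityʳ s) s≡sω²)) ⟩
        ω * (ω * ω)      ≡⟨ *-assoc ω ω ω ⟨
        ω * ω * ω        ≡⟨ ω³≡1 ⟩
        1#               ∎)

    ≡cube⇔∈[s,sω,sω²] : ∀ {ρ s} → ρ ≡ s * s * s → ∀ {t} → ρ ≡ t * t * t ⇔ t ∈ s ∷ s * ω ∷ s * (ω * ω) ∷ []
    ≡cube⇔∈[s,sω,sω²] {ρ} {s} ρ≡s³ {t} = mk⇔ root∈ ∈⇒root
      where
      root∈ : ρ ≡ t * t * t → t ∈ s ∷ s * ω ∷ s * (ω * ω) ∷ []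
      root∈ ρ≡t³ with cube-roots (trans (sym ρ≡t³) ρ≡s³)
      ... | inj₁ t≡s          = here t≡s
      ... | inj₂ (inj₁ t≡sω)  = there (here t≡sω)
      ... | inj₂ (inj₂ t≡sω²) = there (there (here t≡sω²))
      ∈⇒root : t ∈ s ∷ s * ω ∷ s * (ω * ω) ∷ [] → ρ ≡ t * t * t
      ∈⇒root (here refl)                 = ρ≡s³
      ∈⇒root (there (here refl))         = trans ρ≡s³ (sym ([sω]³≡s³ s))
      ∈⇒root (there (there (here refl))) = trans ρ≡s³ (sym ([sω²]³≡s³ s))

module OsculatingPlanes (F : FiniteField) where
  open FiniteField F
  open Geometry F
  open FiniteFieldProperties F
  open ≡-Reasoning

  params! : Unique params
  params! = subst Unique (cong (nothing ∷_) (sym (map-∘ (allFin size))))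
    (All.tabulate nothing≢ ∷ map⁺ just-injective elements!)
    where
    nothing≢ : ∀ {t} → t ∈ map just elements → nothing ≢ t
    nothing≢ t∈ with ∈-map⁻ just t∈
    ... | _ , _ , refl = λ ()

  ∈-params : ∀ t → t ∈ params
  ∈-params nothing  = here refl
  ∈-params (just x) = there (subst (just x ∈_) (sym (map-∘ (allFin size))) (∈-map⁺ just (∈-elements x)))

  oscCount≡length : ∀ {v ts} → Unique ts → (∀ {t} → OnOsc t v ⇔ t ∈ ts) → oscCount v ≡ length ts
  oscCount≡length {v} ts! onOsc⇔∈ = length-filter≡length (onOsc? v) params! ts!
    (mk⇔ (λ t∈ → ∈-params _ , Equivalence.from onOsc⇔∈ t∈) (Equivalence.to onOsc⇔∈ ∘ proj₂))

  oscForm-0≡x0 : ∀ v → oscForm (just 0#) v ≡ x0 v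
  oscForm-0≡x0 ⟨ a , b , c , d ⟩ = begin
    a + - (3# * 0# * b) + 3# * 0# * 0# * c + - (0# * 0# * 0# * d)
      ≡⟨ cong₂ (λ u v → a + u + 3# * 0# * 0# * c + v)
           (-x≡0 (solve 2 (λ h b → h :* con 0 :* b := con 0) refl 3# b))
           (-x≡0 (solve 1 (λ d → con 0 :* con 0 :* con 0 :* d := con 0) refl d)) ⟩
    a + 0# + 3# * 0# * 0# * c + 0#
      ≡⟨ solve 3 (λ a c h → a :+ con 0 :+ h :* con 0 :* con 0 :* c :+ con 0 := a) refl a c 3# ⟩
    a ∎

  OnOsc-x₁≡0⇔ : ∀ {t a c d} → OnOsc (just t) ⟨ a , 0# , c , d ⟩ ⇔ a + 3# * t * t * c ≡ t * t * t * d
  OnOsc-x₁≡0⇔ {t} {a} {c} {d} = ⇔-trans (≡⇔≡ oscForm≡ refl) x-y≡0⇔x≡y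
    where
    oscForm≡ : oscForm (just t) ⟨ a , 0# , c , d ⟩ ≡ a + 3# * t * t * c + - (t * t * t * d)
    oscForm≡ = cong (λ u → u + 3# * t * t * c + - (t * t * t * d))
      (trans (cong (a +_) (-x≡0 (zeroʳ (3# * t)))) (+-identityʳ a))

  OnOsc-K₀⇔ : ∀ {ρ t} → OnOsc (just t) (K ρ (just 0#)) ⇔ ρ ≡ t * t * t
  OnOsc-K₀⇔ {ρ} {t} = ⇔-trans OnOsc-x₁≡0⇔
    (≡⇔≡ (trans (cong (ρ +_) (zeroʳ (3# * t * t))) (+-identityʳ ρ)) (*-identityʳ (t * t * t)))

  OnOsc-K∞⇔ : 3# ≢ 0# → ∀ {ρ t} → OnOsc (just t) (K ρ nothing) ⇔ t ≡ 0#
  OnOsc-K∞⇔ 3≢0 {ρ} {t} = ⇔-trans OnOsc-x₁≡0⇔ (⇔-trans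
    (≡⇔≡ (solve 2 (λ h t → con 0 :+ h :* t :* t :* con 1 := h :* t :* t) refl 3# t) (zeroʳ (t * t * t)))
    (mk⇔ 3t²≡0⇒t≡0 λ t≡0 → trans (cong (λ u → 3# * u * u) t≡0) (solve 1 (λ h → h :* con 0 :* con 0 := con 0) refl 3#)))
    where
    3t²≡0⇒t≡0 : 3# * t * t ≡ 0# → t ≡ 0#
    3t²≡0⇒t≡0 3t²≡0 with t ≟ 0#
    ... | yes t≡0 = t≡0
    ... | no  t≢0 = ⊥-elim (x*y≢0 (x*y≢0 3≢0 t≢0) t≢0 3t²≡0)

  oscCount-K∞ : 3# ≢ 0# → ∀ {ρ} → oscCount (K ρ nothing) ≡ 2
  oscCount-K∞ 3≢0 {ρ} = oscCount≡length (((λ ()) ∷ []) ∷ [] ∷ []) onOsc⇔∈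
    where
    onOsc⇔∈ : ∀ {t} → OnOsc t (K ρ nothing) ⇔ t ∈ nothing ∷ just 0# ∷ []
    onOsc⇔∈ {nothing} = mk⇔ (λ _ → here refl) (λ _ → refl)
    onOsc⇔∈ {just t}  = ⇔-trans (OnOsc-K∞⇔ 3≢0 {ρ}) (mk⇔ (there ∘ here ∘ cong just) λ
      { (here ())
      ; (there (here just-t≡just-0)) → just-injective just-t≡just-0
      ; (there (there ()))
      })

  oscCount-K₀ : ∀ {ρ rs} → Unique rs → (∀ {t} → ρ ≡ t * t * t ⇔ t ∈ rs) → oscCount (K ρ (just 0#)) ≡ length rs
  oscCount-K₀ {ρ} {rs} rs! ≡cube⇔∈ =
    trans (oscCount≡length (map⁺ just-injective rs!) onOsc⇔∈) (length-map just rs)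
    where
    onOsc⇔∈ : ∀ {t} → OnOsc t (K ρ (just 0#)) ⇔ t ∈ map just rs
    onOsc⇔∈ {nothing} = mk⇔ (⊥-elim ∘ 1≢0) λ nothing∈ → case ∈-map⁻ just nothing∈ of λ { (_ , _ , ()) }
    onOsc⇔∈ {just t}  = ⇔-trans OnOsc-K₀⇔ (⇔-trans ≡cube⇔∈ (mk⇔ (∈-map⁺ just) λ just-t∈ →
      case ∈-map⁻ just just-t∈ of λ { (_ , r∈ , refl) → r∈ }))

  ⟨⟩-cong : ∀ {a a′ b b′ c c′ d d′} → a ≡ a′ → b ≡ b′ → c ≡ c′ → d ≡ d′ → ⟨ a , b , c , d ⟩ ≡ ⟨ a′ , b′ , c′ , d′ ⟩
  ⟨⟩-cong refl refl refl refl = refl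

  K₀∉curve : ∀ {ρ} → ρ ≢ 0# → ¬ OnCurve (K ρ (just 0#))
  K₀∉curve ρ≢0 (nothing , c , _ , K≡cP) = 1≢0 (trans (cong x3 K≡cP) (zeroʳ c))
  K₀∉curve {ρ} ρ≢0 (just t , c , c≢0 , K≡cP) = ρ≢0 (begin
    ρ                    ≡⟨ cong x0 K≡cP ⟩
    c * (t * t * t)      ≡⟨ cong (λ u → c * (u * u * u)) t≡0 ⟩
    c * (0# * 0# * 0#)   ≡⟨ solve 1 (λ c → c :* (con 0 :* con 0 :* con 0) := con 0) refl c ⟩
    0#                   ∎)
    where
    t≡0 : t ≡ 0#
    t≡0 = *-cancelˡ c≢0 (trans (sym (cong x2 K≡cP)) (sym (zeroʳ c)))

  K∞∉curve : ∀ {ρ} → ¬ OnCurve (K ρ nothing)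
  K∞∉curve (nothing , c , _   , K≡cP) = 1≢0 (trans (cong x2 K≡cP) (zeroʳ c))
  K∞∉curve (just t  , c , c≢0 , K≡cP) = c≢0 (trans (sym (*-identityʳ c)) (sym (cong x3 K≡cP)))

  K∞∈tangent-at-0 : ∀ {ρ} → OnTangent (just 0#) (K ρ nothing)
  K∞∈tangent-at-0 = 0# , 1# , ⟨⟩-cong
    (solve 1 (λ h → con 0 := con 0 :* (con 0 :* con 0 :* con 0) :+ con 1 :* (h :* con 0 :* con 0)) refl 3#)
    (solve 0 (con 0 := con 0 :* (con 0 :* con 0) :+ con 1 :* ((con 1 :+ con 1) :* con 0)) refl)
    (solve 0 (con 1 := con 0 :* con 0 :+ con 1 :* con 1) refl)
    (solve 0 (con 0 := con 0 :* con 1 :+ con 1 :* con 0) refl)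

  -- x₃ = a = 1, while x₂ = a t + b = 0 and x₁ = a t² + 2 b t = 0 force a t² = 0; so t = b = 0 and ρ = x₀ = 0.
  K₀∉tangents : ∀ {ρ} → ρ ≢ 0# → ¬ OnSomeTangent (K ρ (just 0#))
  K₀∉tangents ρ≢0 (nothing , a , b , K≡) =
    1≢0 (trans (cong x3 K≡) (solve 2 (λ a b → a :* con 0 :+ b :* con 0 := con 0) refl a b))
  K₀∉tangents {ρ} ρ≢0 (just t , a , b , K≡) = ρ≢0 (begin
    ρ                                          ≡⟨ cong x0 K≡ ⟩
    a * (t * t * t) + b * (3# * t * t)         ≡⟨ cong₂ (λ u v → a * (u * u * u) + v * (3# * u * u)) t≡0 b≡0 ⟩
    a * (0# * 0# * 0#) + 0# * (3# * 0# * 0#)   ≡⟨ solve 2 (λ a h → a :* (con 0 :* con 0 :* con 0) :+ con 0 :* (h :* con 0 :* con 0) := con 0) refl a 3# ⟩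
    0#                                         ∎)
    where
    a≡1 : a ≡ 1#
    a≡1 = sym (trans (cong x3 K≡) (solve 2 (λ a b → a :* con 1 :+ b :* con 0 := a) refl a b))
    at+b≡0 : a * t + b * 1# ≡ 0#
    at+b≡0 = sym (cong x2 K≡)
    at²≡0 : a * t * t ≡ 0#
    at²≡0 = +-cancelʳ (a * (t * t) + b * ((1# + 1#) * t)) _ _ (begin
      a * t * t + (a * (t * t) + b * ((1# + 1#) * t))  ≡⟨ solve 3 (λ a b t → a :* t :* t :+ (a :* (t :* t) :+ b :* ((con 1 :+ con 1) :* t)) := (a :* t :+ b :* con 1) :* ((con 1 :+ con 1) :* t)) refl a b t ⟩
      (a * t + b * 1#) * ((1# + 1#) * t)               ≡⟨ cong (_* ((1# + 1#) * t)) at+b≡0 ⟩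
      0# * ((1# + 1#) * t)                             ≡⟨ zeroˡ _ ⟩
      0#                                               ≡⟨ cong x1 K≡ ⟩
      a * (t * t) + b * ((1# + 1#) * t)                ≡⟨ +-identityˡ _ ⟨
      0# + (a * (t * t) + b * ((1# + 1#) * t))         ∎)
    t≡0 : t ≡ 0#
    t≡0 with t ≟ 0#
    ... | yes t≡0 = t≡0
    ... | no  t≢0 = ⊥-elim (x*y≢0 (x*y≢0 (λ a≡0 → 1≢0 (trans (sym a≡1) a≡0)) t≢0) t≢0 at²≡0)
    b≡0 : b ≡ 0#
    b≡0 = begin
      b                  ≡⟨ solve 2 (λ a b → b := a :* con 0 :+ b :* con 1) refl a b ⟩
      a * 0# + b * 1#    ≡⟨ cong (λ u → a * u + b * 1#) t≡0 ⟨
      a * t + b * 1#     ≡⟨ at+b≡0 ⟩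
      0#                 ∎

  K₀-isMuGamma : ∀ {ρ rs} → ρ ≢ 0# → Unique rs → (∀ {t} → ρ ≡ t * t * t ⇔ t ∈ rs) →
                 MuGammaPoint (length rs) (K ρ (just 0#))
  K₀-isMuGamma ρ≢0 rs! ≡cube⇔∈ = K₀∉curve ρ≢0 , K₀∉tangents ρ≢0 ∘ proj₂ , oscCount-K₀ rs! ≡cube⇔∈

  K₀-is0Γ : ∀ {ρ} → ρ ≢ 0# → ¬ IsCube ρ → MuGammaPoint 0 (K ρ (just 0#))
  K₀-is0Γ ρ≢0 ¬cube = K₀-isMuGamma ρ≢0 [] (mk⇔ (λ ρ≡t³ → ⊥-elim (¬cube (_ , ρ≡t³))) λ ())

  K₀-is1Γ : size % 3 ≡ 2 → ∀ {ρ} → ρ ≢ 0# → IsCube ρ → MuGammaPoint 1 (K ρ (just 0#))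
  K₀-is1Γ size%3≡2 ρ≢0 (s , ρ≡s³) = K₀-isMuGamma ρ≢0 ([] ∷ []) (≡cube⇔∈[s] size%3≡2 ρ≢0 ρ≡s³)

  K₀-is3Γ : size % 3 ≡ 1 → 3# ≢ 0# → ∀ {ρ} → ρ ≢ 0# → IsCube ρ → MuGammaPoint 3 (K ρ (just 0#))
  K₀-is3Γ size%3≡1 3≢0 ρ≢0 (s , ρ≡s³) with ∃x²+x+1≡0 size%3≡1
  ... | ω , ω²+ω+1≡0 =
    K₀-isMuGamma ρ≢0 (cube-roots! 3≢0 (s³≢0⇒s≢0 (ρ≢0 ∘ trans ρ≡s³))) (≡cube⇔∈[s,sω,sω²] ρ≡s³)
    where open PrimitiveCubeRootOfUnity ω²+ω+1≡0

lemma3p1 : (F : FiniteField) →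
  let open FiniteField F
      open Geometry F
  in size % 3 ≢ 0 → (ρ : Carrier) → ρ ≢ 0# →
    ((γ : Carrier) → ¬ OnOsc (just 0#) (K ρ (just γ)) × ¬ OnOsc nothing (K ρ (just γ)))
    × (OnOsc (just 0#) (K ρ nothing) × OnOsc nothing (K ρ nothing)
       × ((t : Carrier) → t ≢ 0# → ¬ OnOsc (just t) (K ρ nothing)))
    × ((t : Carrier) → t ≢ 0# →
         (OnOsc (just t) (K ρ (just 0#)) → ρ ≡ t * t * t)
         × (ρ ≡ t * t * t → OnOsc (just t) (K ρ (just 0#))))
    × (oscCount (K ρ nothing) ≡ 2 × TPoint (K ρ nothing))
    × (¬ IsCube ρ → MuGammaPoint 0 (K ρ (just 0#)))
    × (IsCube ρ →
         (size % 3 ≡ 2 → MuGammaPoint 1 (K ρ (just 0#)))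
         × (size % 3 ≡ 1 → MuGammaPoint 3 (K ρ (just 0#))))
lemma3p1 F size%3≢0 ρ ρ≢0 =
    (λ γ → ρ≢0 ∘ trans (sym (oscForm-0≡x0 (K ρ (just γ)))) , 1≢0)
  , (oscForm-0≡x0 (K ρ nothing) , refl , λ t t≢0 → t≢0 ∘ Equivalence.to (OnOsc-K∞⇔ 3≢0 {ρ}))
  , (λ t _ → Equivalence.to OnOsc-K₀⇔ , Equivalence.from OnOsc-K₀⇔)
  , (oscCount-K∞ 3≢0 {ρ} , K∞∉curve {ρ} , just 0# , K∞∈tangent-at-0 {ρ})
  , K₀-is0Γ ρ≢0
  , (λ cube → (λ size%3≡2 → K₀-is1Γ size%3≡2 ρ≢0 cube) , (λ size%3≡1 → K₀-is3Γ size%3≡1 3≢0 ρ≢0 cube))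
  where
  open FiniteField F
  open Geometry F
  open FiniteFieldProperties F
  open OsculatingPlanes F
  3≢0 : 3# ≢ 0#
  3≢0 = 3#≢0 size%3≢0
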